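{- The graph parameters $\widetilde{\Delta}$, $\mathrm{cdeg}$, $\max\{\mathrm{cideg},\widetilde{\omega}\}$, $\max\{\alpha^{\mathrm{loc}},\widetilde{\omega}\}$ and $\max\{\theta^{\mathrm{loc}},\widetilde{\omega}\}$ are pairwise equivalent.
   Context: All graphs finite and simple. Parameters $p,q$ are equivalent if there are functions $f,g:\mathbb{N}\to\mathbb{N}$ with $f(p(G))\le q(G)\le g(p(G))$ for all graphs $G$. Two vertices are equivalent if they lie in exactly the same maximal cliques (true twins); the clique-quotient graph $\widetilde{G}$ has the classes as vertices, distinct classes adjacent iff their vertices are adjacent in $G$; $\widetilde{\Delta}(G)=\Delta(\widetilde{G})$. $\widetilde{\omega}(G)$ is the maximum over maximal cliques $K$ of the number of classes intersecting $K$. $\mathrm{cideg}(G)$ is the maximum over vertices of the number of maximal cliques containing it; $\mathrm{cdeg}(G)$ is the maximum over maximal cliques $K$ of the number of other maximal cliques intersecting $K$. $\mu^{\mathrm{loc}}(G)=\max_v\mu(G[N[v]])$, with $\alpha$ the independence number and $\theta$ the clique-cover number. -}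

module Defs where

open import Data.Nat using (ℕ; zero; suc; _⊔_; _≤_; _<ᵇ_)
open import Data.Bool using (Bool; true; false; _∧_; _∨_; not; if_then_else_)
import Data.Bool as B
open import Data.Fin using (Fin; toℕ; _≟_)
open import Data.List using (List; []; _∷_; map; _++_; foldr; length; filterᵇ; allFin; concatMap)
open import Data.Bool.ListAction using (all; any)
open import Data.Vec using (Vec; lookup; tabulate)
import Data.Vec as V
open import Data.Product using (Σ; _×_)
open import Relation.Binary.PropositionalEquality using (_≡_)
open import Relation.Nullary.Decidable using (⌊_⌋)

record Graph : Set where
  field
    n      : ℕ
    adj    : Fin n → Fin n → Bool
    sym    : ∀ i j → adj i j ≡ adj j i
    irrefl : ∀ i → adj i i ≡ false

maxℕ : List ℕ → ℕ
maxℕ = foldr _⊔_ 0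

count : {A : Set} → (A → Bool) → List A → ℕ
count p xs = length (filterᵇ p xs)

-- least k ≤ fuel with p k (returns fuel if there is none)
leastℕ : (ℕ → Bool) → ℕ → ℕ
leastℕ p zero    = 0
leastℕ p (suc f) = if p 0 then 0 else suc (leastℕ (λ k → p (suc k)) f)

Subset : ℕ → Set
Subset n = Vec Bool n

allSubsets : (n : ℕ) → List (Subset n)
allSubsets zero    = V.[] ∷ []
allSubsets (suc n) = map (false V.∷_) (allSubsets n) ++ map (true V.∷_) (allSubsets n)

subsetTuples : (n : ℕ) → ℕ → List (List (Subset n))
subsetTuples n zero    = [] ∷ []
subsetTuples n (suc k) = concatMap (λ S → map (S ∷_) (subsetTuples n k)) (allSubsets n)

module _ (G : Graph) where
  open Graph G

  vs : List (Fin n)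
  vs = allFin n

  mem : Subset n → Fin n → Bool
  mem S v = lookup S v

  size : Subset n → ℕ
  size S = count (mem S) vs

  _⊆ᵇ_ : Subset n → Subset n → Bool
  S ⊆ᵇ T = all (λ u → not (mem S u) ∨ mem T u) vs

  eqᵇ : Subset n → Subset n → Bool
  eqᵇ S T = (S ⊆ᵇ T) ∧ (T ⊆ᵇ S)

  intersects : Subset n → Subset n → Bool
  intersects S T = any (λ u → mem S u ∧ mem T u) vs

  isClique : Subset n → Bool
  isClique S = all (λ u → all (λ v → not (mem S u ∧ mem S v) ∨ ⌊ u ≟ v ⌋ ∨ adj u v) vs) vs

  isIndep : Subset n → Bool
  isIndep S = all (λ u → all (λ v → not (mem S u ∧ mem S v) ∨ not (adj u v)) vs) vs

  isMaxClique : Subset n → Bool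
  isMaxClique S = isClique S ∧ all (λ T → not (isClique T ∧ (S ⊆ᵇ T) ∧ not (eqᵇ S T))) (allSubsets n)

  maxCliques : List (Subset n)
  maxCliques = filterᵇ isMaxClique (allSubsets n)

  twin : Fin n → Fin n → Bool
  twin u v = all (λ K → ⌊ mem K u B.≟ mem K v ⌋) maxCliques

  -- canonical representative of a twin class: its least element
  isRep : Fin n → Bool
  isRep r = not (any (λ w → (toℕ w <ᵇ toℕ r) ∧ twin w r) vs)

  reps : List (Fin n)
  reps = filterᵇ isRep vs

  N[_] : Fin n → Subset n
  N[ v ] = tabulate (λ u → ⌊ u ≟ v ⌋ ∨ adj v u)

  αIn : Subset n → ℕ
  αIn U = maxℕ (map size (filterᵇ (λ S → (S ⊆ᵇ U) ∧ isIndep S) (allSubsets n)))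

  coverable : Subset n → ℕ → Bool
  coverable U k = any (λ Cs → all (λ C → isClique C ∧ (C ⊆ᵇ U)) Cs
                               ∧ all (λ u → not (mem U u) ∨ any (λ C → mem C u) Cs) vs)
                      (subsetTuples n k)

  -- θ(G[U]) : clique-cover number (U is always coverable by ≤ n cliques)
  θIn : Subset n → ℕ
  θIn U = leastℕ (coverable U) n

-- Δ of the clique-quotient graph (classes represented by least elements)
Δ̃ : Graph → ℕ
Δ̃ G = maxℕ (map (λ r → count (λ s → Graph.adj G r s) (reps G)) (reps G))

ω̃ : Graph → ℕ
ω̃ G = maxℕ (map (λ K → count (λ r → any (λ v → mem G K v ∧ twin G v r) (vs G)) (reps G))
                (maxCliques G))

cideg : Graph → ℕ
cideg G = maxℕ (map (λ v → count (λ K → mem G K v) (maxCliques G)) (vs G))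

cdeg : Graph → ℕ
cdeg G = maxℕ (map (λ K → count (λ K' → not (eqᵇ G K K') ∧ intersects G K K') (maxCliques G))
                   (maxCliques G))

αloc : Graph → ℕ
αloc G = maxℕ (map (λ v → αIn G (N[_] G v)) (vs G))

θloc : Graph → ℕ
θloc G = maxℕ (map (λ v → θIn G (N[_] G v)) (vs G))

Param : Set
Param = Graph → ℕ

Equivalent : Param → Param → Set
Equivalent p q = Σ (ℕ → ℕ) λ f → Σ (ℕ → ℕ) λ g → ∀ G → (f (p G) ≤ q G) × (q G ≤ g (p G))

params : Vec Param 5
params = Δ̃ V.∷ cdeg V.∷ (λ G → cideg G ⊔ ω̃ G) V.∷ (λ G → αloc G ⊔ ω̃ G) V.∷ (λ G → θloc G ⊔ ω̃ G) V.∷ V.[]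

-- Each parameter is bounded by a function of c = max(cideg, ω̃), and c by a function of each
-- parameter, through the cycle
--   cdeg ≤ ω̃ · cideg: every maximal clique meeting K contains the representative of one of the at
--     most ω̃ twin classes meeting K, and each vertex lies in at most cideg maximal cliques;
--   cideg ≤ 1 + cdeg and ω̃ ≤ 2^(1 + cdeg): the maximal cliques through v all meet one of them, and
--     the twin classes inside K are told apart by which maximal cliques meeting K contain them;
--   αloc ≤ θloc ≤ cideg: the maximal cliques through v cover N[v], and an independent set meets
--     every clique at most once;
--   Δ̃ ≤ 2^(ω̃ + αloc + 2): by Ramsey's theorem, more neighbouring classes of a class r would
--     contain more than ω̃ pairwise adjacent classes or more than αloc independent vertices of N[r];
--   ω̃ ≤ 1 + Δ̃ and cideg ≤ 2^(1 + Δ̃): all classes of a maximal clique are adjacent to one of them,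
--     and a maximal clique through v is determined by the classes around the class of v it contains.

module Submission where

open import Data.Bool using (Bool; true; false; T; _∧_; _∨_; not)
import Data.Bool as Bool
open import Data.Bool.Properties using (T-∧; T-∨; T-≡; T-not-≡)
open import Data.Bool.ListAction using (all; any)
open import Data.Empty using (⊥; ⊥-elim)
open import Data.Fin using (Fin; toℕ; _≟_)
open import Data.Fin.Properties using (toℕ-injective)
open import Data.List using (List; []; _∷_; map; _++_; length; filterᵇ)
open import Data.List.Membership.Propositional using (_∈_; find; lose)
open import Data.List.Membership.Propositional.Properties
  using (∈-allFin; ∈-filter⁺; ∈-filter⁻; ∈-map⁺; ∈-map⁻; ∈-++⁺ˡ; ∈-++⁺ʳ;
         ∈-concatMap⁺; ∈-concatMap⁻)
open import Data.List.Properties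
  using (∷-injectiveˡ; ∷-injectiveʳ; filter-none; length-filter; length-tabulate; length-map; length-++;
         length-removeAt′)
open import Data.List.Relation.Unary.All as All using (All; []; _∷_)
open import Data.List.Relation.Unary.All.Properties using (all⁺; all⁻)
open import Data.List.Relation.Unary.Any using (here; there; _─_; index)
open import Data.List.Relation.Unary.Any.Properties using (any⁺; any⁻)
open import Data.List.Relation.Unary.AllPairs using ([]; _∷_)
open import Data.List.Relation.Unary.Unique.Propositional using (Unique)
import Data.List.Relation.Unary.Unique.Propositional.Properties as Unique
open import Data.Nat using (ℕ; zero; suc; _+_; _*_; _^_; _⊔_; _≤_; _<_; z≤n; s≤s; _≤?_; _<ᵇ_)
open import Data.Nat.ListAction using (sum)
open import Data.Nat.Properties hiding (_≟_)
open import Data.Product using (∃; _×_; _,_; proj₁; proj₂)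
open import Data.Sum using (_⊎_; inj₁; inj₂; [_,_]; reduce)
import Data.Sum
open import Data.Vec using (Vec; lookup; tabulate)
import Data.Vec as V
import Data.Vec.Properties as Vₚ
import Data.Vec.Relation.Unary.All as VAll
open VAll using (_∷_; [])
import Data.Vec.Relation.Unary.All.Properties as VAll
open import Function using (_∘_; id; Equivalence)
open import Relation.Binary using (tri<; tri≈; tri>)
open import Relation.Binary.PropositionalEquality
  using (_≡_; _≢_; refl; sym; trans; cong; cong₂; subst; module ≡-Reasoning)
open import Relation.Nullary using (¬_; yes; no)
open import Relation.Nullary.Decidable using (T?; ⌊_⌋; toWitness; fromWitness)

open import Defs

open Equivalence using (to; from)

private variable
  A B : Set

T-extensional : ∀ {a b} → (T a → T b) → (T b → T a) → a ≡ b
T-extensional {false} {false} _ _ = refl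
T-extensional {false} {true} _ b⇒a = ⊥-elim (b⇒a _)
T-extensional {true} {false} a⇒b _ = ⊥-elim (a⇒b _)
T-extensional {true} {true} _ _ = refl

¬T-not⇒T : ∀ {b} → ¬ T (not b) → T b
¬T-not⇒T {false} h = h _
¬T-not⇒T {true} _ = _

¬T⇒T-not : ∀ {b} → ¬ T b → T (not b)
¬T⇒T-not {false} _ = _
¬T⇒T-not {true} h = h _

T-not⇒¬T : ∀ {b} → T (not b) → ¬ T b
T-not⇒¬T {false} _ ()

implicationᵇ⁺ : ∀ {a b} → (T a → T b) → T (not a ∨ b)
implicationᵇ⁺ {false} _ = _
implicationᵇ⁺ {true} h = h _

implicationᵇ⁻ : ∀ {a b} → T (not a ∨ b) → T a → T b
implicationᵇ⁻ {true} h _ = h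

all-lookup : ∀ (p : A → Bool) {xs x} → T (all p xs) → x ∈ xs → T (p x)
all-lookup p {xs} h = All.lookup (all⁺ p xs h)

all-tabulate : ∀ (p : A → Bool) xs → (∀ {x} → x ∈ xs → T (p x)) → T (all p xs)
all-tabulate p _ h = all⁻ p (All.tabulate h)

¬all⇒counterexample : ∀ (p : A → Bool) xs → ¬ T (all p xs) → ∃ λ x → x ∈ xs × ¬ T (p x)
¬all⇒counterexample p [] ¬all = ⊥-elim (¬all _)
¬all⇒counterexample p (x ∷ xs) ¬all with p x in px
... | false = x , here refl , subst T px
... | true  = let y , y∈xs , ¬py = ¬all⇒counterexample p xs ¬all in y , there y∈xs , ¬py

any-find : ∀ (p : A → Bool) xs → T (any p xs) → ∃ λ x → x ∈ xs × T (p x)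
any-find p xs h = find (any⁻ p xs h)

any-lose : ∀ (p : A → Bool) {xs x} → x ∈ xs → T (p x) → T (any p xs)
any-lose p x∈xs px = any⁺ p (lose x∈xs px)

∈-filterᵇ⁺ : ∀ (p : A → Bool) {xs x} → x ∈ xs → T (p x) → x ∈ filterᵇ p xs
∈-filterᵇ⁺ p = ∈-filter⁺ (T? ∘ p)

∈-filterᵇ⁻ : ∀ (p : A → Bool) {xs x} → x ∈ filterᵇ p xs → x ∈ xs × T (p x)
∈-filterᵇ⁻ p = ∈-filter⁻ (T? ∘ p)

unique-filterᵇ : ∀ (p : A → Bool) {xs} → Unique xs → Unique (filterᵇ p xs)
unique-filterᵇ p = Unique.filter⁺ (T? ∘ p)

unique-map-injectiveOn : ∀ (f : A → B) {xs} → Unique xs →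
                         (∀ {x y} → x ∈ xs → y ∈ xs → f x ≡ f y → x ≡ y) → Unique (map f xs)
unique-map-injectiveOn f {[]} _ _ = []
unique-map-injectiveOn f {x ∷ xs} (x∉xs ∷ xs!) inj =
  All.tabulate (λ fy∈ fx≡fy → let y , y∈xs , fy≡ = ∈-map⁻ f fy∈ in
                 All.lookup x∉xs y∈xs (inj (here refl) (there y∈xs) (trans fx≡fy fy≡)))
  ∷ unique-map-injectiveOn f xs! (λ x∈ y∈ → inj (there x∈) (there y∈))

map-≡⇒pointwise : ∀ {f g : A → B} {xs x} → map f xs ≡ map g xs → x ∈ xs → f x ≡ g x
map-≡⇒pointwise {xs = _ ∷ _} fxs≡gxs (here refl) = ∷-injectiveˡ fxs≡gxs
map-≡⇒pointwise {xs = _ ∷ _} fxs≡gxs (there x∈xs) = map-≡⇒pointwise (∷-injectiveʳ fxs≡gxs) x∈xs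

lookup-extensionality : ∀ {k} (S S′ : Vec A k) → (∀ i → lookup S i ≡ lookup S′ i) → S ≡ S′
lookup-extensionality S S′ h = begin
  S                    ≡⟨ Vₚ.tabulate∘lookup S ⟨
  tabulate (lookup S)  ≡⟨ Vₚ.tabulate-cong h ⟩
  tabulate (lookup S′) ≡⟨ Vₚ.tabulate∘lookup S′ ⟩
  S′                   ∎
  where open ≡-Reasoning

-- Counting

maxℕ-upper : ∀ (f : A → ℕ) {xs x} → x ∈ xs → f x ≤ maxℕ (map f xs)
maxℕ-upper f (here refl) = m≤m⊔n _ _
maxℕ-upper f (there x∈xs) = ≤-trans (maxℕ-upper f x∈xs) (m≤n⊔m _ _)

maxℕ-least : ∀ (f : A → ℕ) xs {b} → (∀ {x} → x ∈ xs → f x ≤ b) → maxℕ (map f xs) ≤ b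
maxℕ-least f [] h = z≤n
maxℕ-least f (x ∷ xs) h = ⊔-lub (h (here refl)) (maxℕ-least f xs (h ∘ there))

sum-≤-length* : ∀ (f : A → ℕ) xs {b} → (∀ {x} → x ∈ xs → f x ≤ b) → sum (map f xs) ≤ length xs * b
sum-≤-length* f [] _ = z≤n
sum-≤-length* f (x ∷ xs) h = +-mono-≤ (h (here refl)) (sum-≤-length* f xs (h ∘ there))

unique-⊆⇒length-≤ : ∀ {xs ys : List A} → Unique xs → (∀ {x} → x ∈ xs → x ∈ ys) →
                    length xs ≤ length ys
unique-⊆⇒length-≤ {xs = []} _ _ = z≤n
unique-⊆⇒length-≤ {xs = x ∷ xs} {ys} (x∉xs ∷ xs!) xs⊆ys = begin
  suc (length xs)            ≤⟨ s≤s (unique-⊆⇒length-≤ xs! (λ y∈xs →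
                                  ∈-─ x∈ys (xs⊆ys (there y∈xs)) (All.lookup x∉xs y∈xs ∘ sym))) ⟩
  suc (length (ys ─ x∈ys))   ≡⟨ length-removeAt′ ys (index x∈ys) ⟨
  length ys                  ∎
  where
  open ≤-Reasoning
  x∈ys = xs⊆ys (here refl)
  ∈-─ : ∀ {x y : A} {zs} (x∈zs : x ∈ zs) → y ∈ zs → y ≢ x → y ∈ (zs ─ x∈zs)
  ∈-─ (here refl) (here refl) y≢x = ⊥-elim (y≢x refl)
  ∈-─ (here refl) (there y∈zs) _ = y∈zs
  ∈-─ (there _) (here refl) _ = here refl
  ∈-─ (there x∈zs) (there y∈zs) y≢x = there (∈-─ x∈zs y∈zs y≢x)

module _ (p q : A → Bool) where

  count-mono : ∀ xs → (∀ {x} → x ∈ xs → T (p x) → T (q x)) → count p xs ≤ count q xs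
  count-mono [] _ = z≤n
  count-mono (x ∷ xs) p⇒q with ih ← count-mono xs (p⇒q ∘ there) | p x | q x | p⇒q (here refl)
  ... | true  | true  | _ = s≤s ih
  ... | true  | false | h = ⊥-elim (h _)
  ... | false | true  | _ = m≤n⇒m≤1+n ih
  ... | false | false | _ = ih

  count-mono-< : ∀ xs {z} → (∀ {x} → x ∈ xs → T (p x) → T (q x)) →
                 z ∈ xs → T (q z) → ¬ T (p z) → count p xs < count q xs
  count-mono-< (x ∷ xs) p⇒q (here refl) qz ¬pz with p x | q x
  ... | true  | _     = ⊥-elim (¬pz _)
  ... | false | true  = s≤s (count-mono xs (p⇒q ∘ there))
  ... | false | false = ⊥-elim qz
  count-mono-< (x ∷ xs) p⇒q (there z∈xs) qz ¬pz
    with ih ← count-mono-< xs (p⇒q ∘ there) z∈xs qz ¬pz | p x | q x | p⇒q (here refl)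
  ... | true  | true  | _ = s≤s ih
  ... | true  | false | h = ⊥-elim (h _)
  ... | false | true  | _ = m≤n⇒m≤1+n ih
  ... | false | false | _ = ih

  count-∨ : ∀ (r : A → Bool) xs → (∀ {x} → x ∈ xs → T (r x) → T (p x) ⊎ T (q x)) →
            count r xs ≤ count p xs + count q xs
  count-∨ r [] _ = z≤n
  count-∨ r (x ∷ xs) r⇒p∨q with ih ← count-∨ r xs (r⇒p∨q ∘ there) | r x | p x | q x | r⇒p∨q (here refl)
  ... | false | false | false | _ = ih
  ... | false | false | true  | _ = ≤-trans ih (+-monoʳ-≤ _ (n≤1+n _))
  ... | false | true  | false | _ = m≤n⇒m≤1+n ih
  ... | false | true  | true  | _ = m≤n⇒m≤1+n (≤-trans ih (+-monoʳ-≤ _ (n≤1+n _)))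
  ... | true  | false | false | h = ⊥-elim (reduce (h _))
  ... | true  | false | true  | _ = ≤-trans (s≤s ih) (≤-reflexive (sym (+-suc _ _)))
  ... | true  | true  | false | _ = s≤s ih
  ... | true  | true  | true  | _ = s≤s (≤-trans ih (+-monoʳ-≤ _ (n≤1+n _)))

module _ (p : A → Bool) where

  count-≤-length : ∀ xs → count p xs ≤ length xs
  count-≤-length = length-filter (T? ∘ p)

  count+count-not : ∀ xs → count p xs + count (not ∘ p) xs ≡ length xs
  count+count-not [] = refl
  count+count-not (x ∷ xs) with p x
  ... | true  = cong suc (count+count-not xs)
  ... | false = trans (+-suc _ _) (cong suc (count+count-not xs))

  length-≤-count : ∀ xs {ys} → Unique ys → (∀ {y} → y ∈ ys → y ∈ xs × T (p y)) →
                   length ys ≤ count p xs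
  length-≤-count xs ys! ys⊆ =
    unique-⊆⇒length-≤ ys! (λ y∈ys → let y∈xs , py = ys⊆ y∈ys in ∈-filterᵇ⁺ p y∈xs py)

  count-≤1 : ∀ {xs} → Unique xs → (∀ {x y} → x ∈ xs → y ∈ xs → T (p x) → T (p y) → x ≡ y) →
             count p xs ≤ 1
  count-≤1 {xs} xs! unique-p = subsingleton (unique-filterᵇ p xs!) λ x∈ y∈ →
    let x∈xs , px = ∈-filterᵇ⁻ p x∈ ; y∈xs , py = ∈-filterᵇ⁻ p y∈ in unique-p x∈xs y∈xs px py
    where
    subsingleton : ∀ {ys : List A} → Unique ys → (∀ {x y} → x ∈ ys → y ∈ ys → x ≡ y) → length ys ≤ 1
    subsingleton {[]} _ _ = z≤n
    subsingleton {_ ∷ []} _ _ = s≤s z≤n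
    subsingleton {_ ∷ _ ∷ _} ((x≢y ∷ _) ∷ _) all-equal =
      ⊥-elim (x≢y (all-equal (here refl) (there (here refl))))

  count-≤-from-witness : ∀ xs {b} → (∀ {x} → x ∈ xs → T (p x) → count p xs ≤ b) → count p xs ≤ b
  count-≤-from-witness xs h with filterᵇ p xs in eq
  ... | [] = z≤n
  ... | x ∷ _ = let x∈xs , px = ∈-filterᵇ⁻ p (subst (x ∈_) (sym eq) (here refl)) in h x∈xs px

count-any-≤-sum : ∀ {R : Set} (q : R → A → Bool) rs xs →
                  count (λ x → any (λ r → q r x) rs) xs ≤ sum (map (λ r → count (q r) xs) rs)
count-any-≤-sum q [] xs = ≤-reflexive (cong length (filter-none (T? ∘ _) (All.universal (λ _ ()) xs)))
count-any-≤-sum q (r ∷ rs) xs =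
  ≤-trans (count-∨ (q r) _ _ xs (λ _ → to T-∨))
          (+-monoʳ-≤ (count (q r) xs) (count-any-≤-sum q rs xs))

boolLists : ℕ → List (List Bool)
boolLists zero = [] ∷ []
boolLists (suc k) = map (false ∷_) (boolLists k) ++ map (true ∷_) (boolLists k)

length-boolLists : ∀ k → length (boolLists k) ≡ 2 ^ k
length-boolLists zero = refl
length-boolLists (suc k) = begin
  length (map (false ∷_) (boolLists k) ++ map (true ∷_) (boolLists k))
    ≡⟨ length-++ (map (false ∷_) (boolLists k)) ⟩
  length (map (false ∷_) (boolLists k)) + length (map (true ∷_) (boolLists k))
    ≡⟨ cong₂ _+_ (length-map (false ∷_) (boolLists k)) (length-map (true ∷_) (boolLists k)) ⟩
  length (boolLists k) + length (boolLists k)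
    ≡⟨ cong (λ m → m + m) (length-boolLists k) ⟩
  2 ^ k + 2 ^ k
    ≡⟨ cong (2 ^ k +_) (sym (+-identityʳ (2 ^ k))) ⟩
  2 ^ suc k ∎
  where open ≡-Reasoning

∈-boolLists : ∀ (bs : List Bool) → bs ∈ boolLists (length bs)
∈-boolLists [] = here refl
∈-boolLists (false ∷ bs) = ∈-++⁺ˡ (∈-map⁺ (false ∷_) (∈-boolLists bs))
∈-boolLists (true ∷ bs) =
  ∈-++⁺ʳ (map (false ∷_) (boolLists (length bs))) (∈-map⁺ (true ∷_) (∈-boolLists bs))

length-≤-2^-by-code : ∀ (code : A → List Bool) {xs} k → Unique xs →
                      (∀ {x y} → x ∈ xs → y ∈ xs → code x ≡ code y → x ≡ y) →
                      (∀ {x} → x ∈ xs → length (code x) ≡ k) → length xs ≤ 2 ^ k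
length-≤-2^-by-code code {xs} k xs! code-inj code-length = begin
  length xs             ≡⟨ length-map code xs ⟨
  length (map code xs)  ≤⟨ unique-⊆⇒length-≤ (unique-map-injectiveOn code xs! code-inj) code∈ ⟩
  length (boolLists k)  ≡⟨ length-boolLists k ⟩
  2 ^ k                 ∎
  where
  open ≤-Reasoning
  code∈ : ∀ {bs} → bs ∈ map code xs → bs ∈ boolLists k
  code∈ bs∈ with x , x∈xs , refl ← ∈-map⁻ code bs∈ =
    subst (λ m → code x ∈ boolLists m) (code-length x∈xs) (∈-boolLists (code x))

-- Ramsey's theorem

+-≤-suc-split : ∀ {m n k l} → m + n ≤ suc (k + l) → m ≤ k ⊎ n ≤ l
+-≤-suc-split {m} {n} {k} {l} m+n≤1+k+l with m ≤? k | n ≤? l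
... | yes m≤k | _       = inj₁ m≤k
... | no _    | yes n≤l = inj₂ n≤l
... | no m≰k  | no n≰l  = ⊥-elim (<⇒≱ (begin-strict
  suc (k + l)      ≡⟨ +-suc k l ⟨
  k + suc l        <⟨ +-mono-≤ (≰⇒> m≰k) (≰⇒> n≰l) ⟩
  m + n            ∎) m+n≤1+k+l)
  where open ≤-Reasoning

module Ramsey (E : A → A → Bool) (E-sym : ∀ x y → E x y ≡ E y x) where

  record Homogeneous (colour : Bool) (k : ℕ) (xs : List A) : Set where
    field
      members     : List A
      members⊆    : ∀ {y} → y ∈ members → y ∈ xs
      unique      : Unique members
      k≤length    : k ≤ length members
      homogeneous : ∀ {u v} → u ∈ members → v ∈ members → u ≢ v → E u v ≡ colour

  ∅-homogeneous : ∀ {c xs} → Homogeneous c 0 xs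
  ∅-homogeneous = record
    { members = [] ; members⊆ = λ () ; unique = [] ; k≤length = z≤n ; homogeneous = λ () }

  weaken : ∀ {c k x xs ys} → (∀ {y} → y ∈ ys → y ∈ xs) → Homogeneous c k ys → Homogeneous c k (x ∷ xs)
  weaken ys⊆xs H = record { Homogeneous H ; members⊆ = there ∘ ys⊆xs ∘ Homogeneous.members⊆ H }

  extend : ∀ {c k x xs ys} → All (x ≢_) xs → (∀ {y} → y ∈ ys → y ∈ xs × E x y ≡ c) →
           Homogeneous c k ys → Homogeneous c (suc k) (x ∷ xs)
  extend {c} {x = x} x∉xs ys⊆ H = record
    { members     = x ∷ members
    ; members⊆    = λ { (here refl) → here refl ; (there y∈) → there (inner y∈ .proj₁) }
    ; unique      = All.tabulate (λ y∈ → All.lookup x∉xs (inner y∈ .proj₁)) ∷ unique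
    ; k≤length    = s≤s k≤length
    ; homogeneous = homogeneous′
    }
    where
    open Homogeneous H
    inner : ∀ {y} → y ∈ members → y ∈ _ × E x y ≡ c
    inner = ys⊆ ∘ members⊆
    homogeneous′ : ∀ {u v} → u ∈ x ∷ members → v ∈ x ∷ members → u ≢ v → E u v ≡ c
    homogeneous′ (here refl) (here refl) u≢v = ⊥-elim (u≢v refl)
    homogeneous′ (here refl) (there v∈) _ = inner v∈ .proj₂
    homogeneous′ (there u∈) (here refl) _ = trans (E-sym _ _) (inner u∈ .proj₂)
    homogeneous′ (there u∈) (there v∈) u≢v = homogeneous u∈ v∈ u≢v

  ramsey : ∀ a b xs → Unique xs → 2 ^ (a + b) ≤ length xs → Homogeneous true a xs ⊎ Homogeneous false b xs
  ramsey zero b xs _ _ = inj₁ ∅-homogeneous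
  ramsey (suc a) zero xs _ _ = inj₂ ∅-homogeneous
  ramsey (suc a) (suc b) [] _ big = ⊥-elim (<⇒≱ (m^n>0 2 (suc a + suc b)) big)
  ramsey (suc a) (suc b) (x ∷ xs) (x∉xs ∷ xs!) big with +-≤-suc-split split-big
    where
    split-big : 2 ^ (a + suc b) + 2 ^ (suc a + b) ≤ suc (count (E x) xs + count (not ∘ E x) xs)
    split-big = begin
      2 ^ (a + suc b) + 2 ^ (suc a + b)  ≡⟨ cong (λ e → 2 ^ (a + suc b) + 2 ^ e) (+-suc a b) ⟨
      2 ^ (a + suc b) + 2 ^ (a + suc b)  ≡⟨ cong (2 ^ (a + suc b) +_) (+-identityʳ _) ⟨
      2 ^ (suc a + suc b)                ≤⟨ big ⟩
      suc (length xs)                    ≡⟨ cong suc (count+count-not (E x) xs) ⟨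
      suc (count (E x) xs + count (not ∘ E x) xs) ∎
      where open ≤-Reasoning
  ... | inj₁ many-E with ramsey a (suc b) (filterᵇ (E x) xs) (unique-filterᵇ (E x) xs!) many-E
  ...   | inj₁ H = inj₁ (extend x∉xs (λ y∈ → let y∈xs , Exy = ∈-filterᵇ⁻ (E x) y∈ in
                                                y∈xs , to T-≡ Exy) H)
  ...   | inj₂ H = inj₂ (weaken (proj₁ ∘ ∈-filterᵇ⁻ (E x)) H)
  ramsey (suc a) (suc b) (x ∷ xs) (x∉xs ∷ xs!) big
      | inj₂ many-¬E with ramsey (suc a) b (filterᵇ (not ∘ E x) xs) (unique-filterᵇ (not ∘ E x) xs!) many-¬E
  ...   | inj₁ H = inj₁ (weaken (proj₁ ∘ ∈-filterᵇ⁻ (not ∘ E x)) H)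
  ...   | inj₂ H = inj₂ (extend x∉xs (λ y∈ → let y∈xs , ¬Exy = ∈-filterᵇ⁻ (not ∘ E x) y∈ in
                                                y∈xs , to T-not-≡ ¬Exy) H)

leastℕ-≤ : ∀ (p : ℕ → Bool) fuel k → T (p k) → leastℕ p fuel ≤ k
leastℕ-≤ p zero k _ = z≤n
leastℕ-≤ p (suc fuel) k pk with p 0 in p0
... | true = z≤n
leastℕ-≤ p (suc fuel) zero pk    | false = ⊥-elim (subst T p0 pk)
leastℕ-≤ p (suc fuel) (suc k) pk | false = s≤s (leastℕ-≤ (p ∘ suc) fuel k pk)

leastℕ-found-or-fuel : ∀ (p : ℕ → Bool) fuel → T (p (leastℕ p fuel)) ⊎ leastℕ p fuel ≡ fuel
leastℕ-found-or-fuel p zero = inj₂ refl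
leastℕ-found-or-fuel p (suc fuel) with p 0 in p0
... | true = inj₁ (subst T (sym p0) _)
... | false with leastℕ-found-or-fuel (p ∘ suc) fuel
...   | inj₁ found     = inj₁ found
...   | inj₂ exhausted = inj₂ (cong suc exhausted)

∈-allSubsets : ∀ {k} (S : Subset k) → S ∈ allSubsets k
∈-allSubsets V.[] = here refl
∈-allSubsets (false V.∷ S) = ∈-++⁺ˡ (∈-map⁺ (false V.∷_) (∈-allSubsets S))
∈-allSubsets (true V.∷ S) = ∈-++⁺ʳ (map (false V.∷_) (allSubsets _)) (∈-map⁺ (true V.∷_) (∈-allSubsets S))

allSubsets-unique : ∀ k → Unique (allSubsets k)
allSubsets-unique zero = [] ∷ []
allSubsets-unique (suc k) =
  Unique.++⁺ (Unique.map⁺ Vₚ.∷-injectiveʳ (allSubsets-unique k))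
             (Unique.map⁺ Vₚ.∷-injectiveʳ (allSubsets-unique k))
             (λ (f∈ , t∈) → false≢true f∈ t∈)
  where
  false≢true : ∀ {S} → S ∈ map (false V.∷_) (allSubsets k) → S ∈ map (true V.∷_) (allSubsets k) → ⊥
  false≢true f∈ t∈ with _ , _ , refl ← ∈-map⁻ (false V.∷_) f∈ | _ , _ , () ← ∈-map⁻ (true V.∷_) t∈

∈-subsetTuples : ∀ {n} (Cs : List (Subset n)) → Cs ∈ subsetTuples n (length Cs)
∈-subsetTuples [] = here refl
∈-subsetTuples {n} (C ∷ Cs) =
  ∈-concatMap⁺ (λ S → map (S ∷_) (subsetTuples n (length Cs)))
               (lose (∈-allSubsets C) (∈-map⁺ (C ∷_) (∈-subsetTuples Cs)))

length-∈-subsetTuples : ∀ {n} k {Cs : List (Subset n)} → Cs ∈ subsetTuples n k → length Cs ≡ k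
length-∈-subsetTuples zero (here refl) = refl
length-∈-subsetTuples {n} (suc k) Cs∈
  with S , _ , Cs∈′ ← find (∈-concatMap⁻ (λ S → map (S ∷_) (subsetTuples n k)) {allSubsets n} Cs∈)
  with _ , Cs′∈ , refl ← ∈-map⁻ (S ∷_) Cs∈′ = cong suc (length-∈-subsetTuples k Cs′∈)

module _ (G : Graph) where
  open Graph G using (n; adj) renaming (sym to adj-sym; irrefl to adj-irrefl)

  -- Subsets and cliques

  infix 4 _∈ₛ_ _⊆ₛ_

  _∈ₛ_ : Fin n → Subset n → Set
  u ∈ₛ S = T (mem G S u)

  _⊆ₛ_ : Subset n → Subset n → Set
  S ⊆ₛ S′ = ∀ {u} → u ∈ₛ S → u ∈ₛ S′

  ∈-vs : ∀ u → u ∈ vs G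
  ∈-vs = ∈-allFin

  vs-unique : Unique (vs G)
  vs-unique = Unique.allFin⁺ n

  ⊆ᵇ⁺ : ∀ {S S′} → S ⊆ₛ S′ → T (_⊆ᵇ_ G S S′)
  ⊆ᵇ⁺ S⊆S′ = all-tabulate _ (vs G) (λ _ → implicationᵇ⁺ S⊆S′)

  ⊆ᵇ⁻ : ∀ {S S′} → T (_⊆ᵇ_ G S S′) → S ⊆ₛ S′
  ⊆ᵇ⁻ h {u} = implicationᵇ⁻ (all-lookup _ h (∈-vs u))

  ¬⊆ᵇ⇒witness : ∀ {S S′} → ¬ T (_⊆ᵇ_ G S S′) → ∃ λ u → u ∈ₛ S × ¬ u ∈ₛ S′
  ¬⊆ᵇ⇒witness h with u , _ , ¬implication ← ¬all⇒counterexample _ (vs G) h =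
    u , ¬T-not⇒T (¬implication ∘ from T-∨ ∘ inj₁) , ¬implication ∘ from T-∨ ∘ inj₂

  eqᵇ⇒≡ : ∀ {S S′} → T (eqᵇ G S S′) → S ≡ S′
  eqᵇ⇒≡ {S} {S′} h = let S⊆S′ , S′⊆S = to (T-∧ {_⊆ᵇ_ G S S′}) h in
    lookup-extensionality S S′ (λ u → T-extensional (⊆ᵇ⁻ {S} {S′} S⊆S′) (⊆ᵇ⁻ {S′} {S} S′⊆S))

  size-≤-n : ∀ S → size G S ≤ n
  size-≤-n S = ≤-trans (count-≤-length (mem G S) (vs G)) (≤-reflexive (length-tabulate id))

  ⊂⇒size-< : ∀ {S S′} → S ⊆ₛ S′ → ¬ T (eqᵇ G S S′) → size G S < size G S′
  ⊂⇒size-< {S} {S′} S⊆S′ S≢S′ =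
    let u , u∈S′ , u∉S = ¬⊆ᵇ⇒witness {S′} {S} (S≢S′ ∘ from T-∧ ∘ (⊆ᵇ⁺ {S} {S′} S⊆S′ ,_))
    in count-mono-< (mem G S) (mem G S′) (vs G) (λ _ → S⊆S′) (∈-vs u) u∈S′ u∉S

  fromList : List (Fin n) → Subset n
  fromList ys = tabulate (λ u → any (λ y → ⌊ u ≟ y ⌋) ys)

  ∈ₛ-fromList⁺ : ∀ {ys u} → u ∈ ys → u ∈ₛ fromList ys
  ∈ₛ-fromList⁺ {ys} {u} u∈ys =
    subst T (sym (Vₚ.lookup∘tabulate _ u)) (any-lose (λ y → ⌊ u ≟ y ⌋) u∈ys (fromWitness refl))

  ∈ₛ-fromList⁻ : ∀ ys {u} → u ∈ₛ fromList ys → u ∈ ys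
  ∈ₛ-fromList⁻ ys {u} u∈
    with y , y∈ys , u≡y ← any-find (λ y → ⌊ u ≟ y ⌋) ys (subst T (Vₚ.lookup∘tabulate _ u) u∈) =
    subst (_∈ ys) (sym (toWitness u≡y)) y∈ys

  size-fromList : ∀ {ys} → Unique ys → length ys ≤ size G (fromList ys)
  size-fromList ys! = length-≤-count _ (vs G) ys! (λ {y} y∈ys → ∈-vs y , ∈ₛ-fromList⁺ y∈ys)

  ∈ₛ-N[]⁺ : ∀ {v u} → u ≡ v ⊎ T (adj v u) → u ∈ₛ N[_] G v
  ∈ₛ-N[]⁺ {v} {u} u~v = subst T (sym (Vₚ.lookup∘tabulate _ u)) (from T-∨ (Data.Sum.map₁ fromWitness u~v))

  ∈ₛ-N[]⁻ : ∀ {v u} → u ∈ₛ N[_] G v → u ≡ v ⊎ T (adj v u)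
  ∈ₛ-N[]⁻ {v} {u} u∈ = Data.Sum.map₁ toWitness (to T-∨ (subst T (Vₚ.lookup∘tabulate _ u) u∈))

  isClique⁺ : ∀ S → (∀ {u v} → u ∈ₛ S → v ∈ₛ S → u ≢ v → T (adj u v)) → T (isClique G S)
  isClique⁺ _ adjacent = all-tabulate _ (vs G) λ {u} _ → all-tabulate _ (vs G) λ {v} _ →
    implicationᵇ⁺ λ uv∈S → let u∈S , v∈S = to T-∧ uv∈S in equal-or-adjacent u v (adjacent u∈S v∈S)
    where
    equal-or-adjacent : ∀ u v → (u ≢ v → T (adj u v)) → T (⌊ u ≟ v ⌋ ∨ adj u v)
    equal-or-adjacent u v h with u ≟ v
    ... | yes _  = _
    ... | no u≢v = h u≢v

  isClique⁻ : ∀ S → T (isClique G S) → ∀ {u v} → u ∈ₛ S → v ∈ₛ S → u ≢ v → T (adj u v)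
  isClique⁻ _ h {u} {v} u∈S v∈S u≢v
    with to T-∨ (implicationᵇ⁻ (all-lookup _ (all-lookup _ h (∈-vs u)) (∈-vs v)) (from T-∧ (u∈S , v∈S)))
  ... | inj₁ u≡v = ⊥-elim (u≢v (toWitness u≡v))
  ... | inj₂ uv  = uv

  isIndep⁺ : ∀ S → (∀ {u v} → u ∈ₛ S → v ∈ₛ S → ¬ T (adj u v)) → T (isIndep G S)
  isIndep⁺ _ nonadjacent = all-tabulate _ (vs G) λ _ → all-tabulate _ (vs G) λ _ →
    implicationᵇ⁺ λ uv∈S → let u∈S , v∈S = to T-∧ uv∈S in ¬T⇒T-not (nonadjacent u∈S v∈S)

  isIndep⁻ : ∀ S → T (isIndep G S) → ∀ {u v} → u ∈ₛ S → v ∈ₛ S → ¬ T (adj u v)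
  isIndep⁻ _ h {u} {v} u∈S v∈S =
    T-not⇒¬T (implicationᵇ⁻ (all-lookup _ (all-lookup _ h (∈-vs u)) (∈-vs v)) (from T-∧ (u∈S , v∈S)))

  ∈-maxCliques⁺ : ∀ {K} → T (isMaxClique G K) → K ∈ maxCliques G
  ∈-maxCliques⁺ {K} = ∈-filterᵇ⁺ (isMaxClique G) (∈-allSubsets K)

  ∈-maxCliques⁻ : ∀ {K} → K ∈ maxCliques G → T (isMaxClique G K)
  ∈-maxCliques⁻ = proj₂ ∘ ∈-filterᵇ⁻ (isMaxClique G) {allSubsets n}

  maxCliques-unique : Unique (maxCliques G)
  maxCliques-unique = unique-filterᵇ (isMaxClique G) (allSubsets-unique n)

  maxClique⇒clique : ∀ {K} → K ∈ maxCliques G → T (isClique G K)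
  maxClique⇒clique = proj₁ ∘ to T-∧ ∘ ∈-maxCliques⁻

  maxClique⊆N[] : ∀ {K v} → K ∈ maxCliques G → v ∈ₛ K → K ⊆ₛ N[_] G v
  maxClique⊆N[] {K} {v} K∈ v∈K {u} u∈K with u ≟ v
  ... | yes u≡v = ∈ₛ-N[]⁺ (inj₁ u≡v)
  ... | no u≢v  = ∈ₛ-N[]⁺ (inj₂ (isClique⁻ K (maxClique⇒clique K∈) v∈K u∈K (u≢v ∘ sym)))

  nonmaximal⇒larger-clique : ∀ {S} → T (isClique G S) → ¬ T (isMaxClique G S) →
                             ∃ λ S′ → T (isClique G S′) × S ⊆ₛ S′ × size G S < size G S′
  nonmaximal⇒larger-clique {S} S-clique S-nonmax =
    let S′ , _ , ¬¬larger = ¬all⇒counterexample _ (allSubsets n) (S-nonmax ∘ from T-∧ ∘ (S-clique ,_))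
        S′-clique , S⊆ᵇS′∧S≢S′ = to T-∧ (¬T-not⇒T ¬¬larger)
        S⊆ᵇS′ , S≢S′ = to T-∧ S⊆ᵇS′∧S≢S′
        S⊆S′ = ⊆ᵇ⁻ {S} {S′} S⊆ᵇS′
    in S′ , S′-clique , S⊆S′ , ⊂⇒size-< {S} {S′} S⊆S′ (T-not⇒¬T S≢S′)

  clique⊆maxClique : ∀ {S} → T (isClique G S) → ∃ λ K → K ∈ maxCliques G × S ⊆ₛ K
  clique⊆maxClique {S} S-clique = grow n {S} S-clique (m≤n+m n (size G S))
    where
    grow : ∀ fuel {S} → T (isClique G S) → n ≤ size G S + fuel → ∃ λ K → K ∈ maxCliques G × S ⊆ₛ K
    grow fuel {S} S-clique enough with isMaxClique G S in S-max
    ... | true = S , ∈-maxCliques⁺ {S} (subst T (sym S-max) _) , id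
    ... | false with S′ , S′-clique , S⊆S′ , S<S′ ← nonmaximal⇒larger-clique {S} S-clique (subst T S-max)
                   | fuel
    ...   | zero =
      ⊥-elim (<⇒≱ (≤-trans S<S′ (size-≤-n S′)) (≤-trans enough (≤-reflexive (+-identityʳ _))))
    ...   | suc fuel′ =
      let K , K-max , S′⊆K = grow fuel′ {S′} S′-clique
                               (≤-trans enough (≤-trans (≤-reflexive (+-suc _ fuel′))
                                                         (+-monoˡ-≤ fuel′ S<S′)))
      in K , K-max , λ {u} → S′⊆K {u} ∘ S⊆S′ {u}

  equal-or-adjacent⇒maxClique : ∀ {u v} → u ≡ v ⊎ T (adj u v) →
                                ∃ λ K → K ∈ maxCliques G × u ∈ₛ K × v ∈ₛ K
  equal-or-adjacent⇒maxClique {u} {v} u~v =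
    let uv = u ∷ v ∷ []
        uv-clique = isClique⁺ (fromList uv) λ x∈ y∈ →
                      adjacent (∈ₛ-fromList⁻ uv x∈) (∈ₛ-fromList⁻ uv y∈)
        K , K-max , uv⊆K = clique⊆maxClique {fromList uv} uv-clique
    in K , K-max , uv⊆K (∈ₛ-fromList⁺ {uv} (here refl)) , uv⊆K (∈ₛ-fromList⁺ {uv} (there (here refl)))
    where
    adjacent : ∀ {x y} → x ∈ u ∷ v ∷ [] → y ∈ u ∷ v ∷ [] → x ≢ y → T (adj x y)
    adjacent (here refl) (here refl) x≢y = ⊥-elim (x≢y refl)
    adjacent (there (here refl)) (there (here refl)) x≢y = ⊥-elim (x≢y refl)
    adjacent (here refl) (there (here refl)) x≢y = [ ⊥-elim ∘ x≢y , id ] u~v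
    adjacent (there (here refl)) (here refl) x≢y = [ ⊥-elim ∘ x≢y ∘ sym , subst T (adj-sym u v) ] u~v

  -- Twins and representatives

  twin⁺ : ∀ {u v} → (∀ {K} → K ∈ maxCliques G → mem G K u ≡ mem G K v) → T (twin G u v)
  twin⁺ same = all-tabulate _ (maxCliques G) (fromWitness ∘ same)

  twin⁻ : ∀ {u v K} → T (twin G u v) → K ∈ maxCliques G → mem G K u ≡ mem G K v
  twin⁻ {u} {v} h = toWitness ∘ all-lookup (λ K → ⌊ mem G K u Bool.≟ mem G K v ⌋) h

  twin-refl : ∀ u → T (twin G u u)
  twin-refl u = twin⁺ (λ _ → refl)

  twin-sym : ∀ {u v} → T (twin G u v) → T (twin G v u)
  twin-sym h = twin⁺ (sym ∘ twin⁻ h)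

  twin-trans : ∀ {u v w} → T (twin G u v) → T (twin G v w) → T (twin G u w)
  twin-trans h h′ = twin⁺ (λ K∈ → trans (twin⁻ h K∈) (twin⁻ h′ K∈))

  twin-∈ₛ : ∀ {u v K} → T (twin G u v) → K ∈ maxCliques G → u ∈ₛ K → v ∈ₛ K
  twin-∈ₛ h K∈ = subst T (twin⁻ h K∈)

  ∈-reps⁻ : ∀ {r} → r ∈ reps G → T (isRep G r)
  ∈-reps⁻ = proj₂ ∘ ∈-filterᵇ⁻ (isRep G) {vs G}

  reps-unique : Unique (reps G)
  reps-unique = unique-filterᵇ (isRep G) vs-unique

  rep-minimal : ∀ {r w} → r ∈ reps G → toℕ w < toℕ r → ¬ T (twin G w r)
  rep-minimal {r} {w} r∈ w<r w~r =
    T-not⇒¬T (∈-reps⁻ r∈) (any-lose _ (∈-vs w) (from T-∧ (<⇒<ᵇ w<r , w~r)))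

  twin-reps⇒≡ : ∀ {r s} → r ∈ reps G → s ∈ reps G → T (twin G r s) → r ≡ s
  twin-reps⇒≡ {r} {s} r∈ s∈ r~s with <-cmp (toℕ r) (toℕ s)
  ... | tri< r<s _ _ = ⊥-elim (rep-minimal s∈ r<s r~s)
  ... | tri≈ _ r≡s _ = toℕ-injective r≡s
  ... | tri> _ _ s<r = ⊥-elim (rep-minimal r∈ s<r (twin-sym r~s))

  rep : ∀ v → ∃ λ r → r ∈ reps G × T (twin G v r)
  rep v = rep-below (suc (toℕ v)) v ≤-refl
    where
    rep-below : ∀ k v → toℕ v < k → ∃ λ r → r ∈ reps G × T (twin G v r)
    rep-below (suc k) v v<k with isRep G v in v-rep
    ... | true = v , ∈-filterᵇ⁺ (isRep G) (∈-vs v) (subst T (sym v-rep) _) , twin-refl v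
    ... | false =
      let w , _ , w<v∧w~v = any-find (λ w → (toℕ w <ᵇ toℕ v) ∧ twin G w v) (vs G) (¬T-not⇒T (subst T v-rep))
          w<v , w~v = to T-∧ w<v∧w~v
          r , r∈ , w~r = rep-below k w (≤-trans (<ᵇ⇒< (toℕ w) (toℕ v) w<v) (≤-pred v<k))
      in r , r∈ , twin-trans (twin-sym w~v) w~r

  meets : Subset n → Fin n → Bool
  meets K r = any (λ v → mem G K v ∧ twin G v r) (vs G)

  ∈ₛ⇒meets : ∀ {K r} → r ∈ₛ K → T (meets K r)
  ∈ₛ⇒meets {K} {r} r∈K = any-lose (λ v → mem G K v ∧ twin G v r) (∈-vs r) (from T-∧ (r∈K , twin-refl r))

  meets⇒∈ₛ : ∀ {K r} → K ∈ maxCliques G → T (meets K r) → r ∈ₛ K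
  meets⇒∈ₛ {K} {r} K∈ h =
    let v , _ , v∈K∧v~r = any-find (λ v → mem G K v ∧ twin G v r) (vs G) h
        v∈K , v~r = to T-∧ v∈K∧v~r
    in twin-∈ₛ v~r K∈ v∈K

  classesIn : Subset n → List (Fin n)
  classesIn K = filterᵇ (meets K) (reps G)

  overlapping : Subset n → Subset n → Bool
  overlapping K K′ = not (eqᵇ G K K′) ∧ intersects G K K′

  closedNeighbour : Fin n → Fin n → Bool
  closedNeighbour r s = ⌊ s ≟ r ⌋ ∨ adj r s

  maxClique-closedNeighbour : ∀ {K r s} → K ∈ maxCliques G → r ∈ₛ K → s ∈ₛ K → T (closedNeighbour r s)
  maxClique-closedNeighbour {K} {r} {s} K∈ r∈K s∈K with s ≟ r
  ... | yes _  = _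
  ... | no s≢r = isClique⁻ K (maxClique⇒clique K∈) r∈K s∈K (s≢r ∘ sym)

  ω̃-upper : ∀ {K} → K ∈ maxCliques G → count (meets K) (reps G) ≤ ω̃ G
  ω̃-upper = maxℕ-upper (λ K → count (meets K) (reps G))

  cideg-upper : ∀ v → count (λ K → mem G K v) (maxCliques G) ≤ cideg G
  cideg-upper v = maxℕ-upper (λ v → count (λ K → mem G K v) (maxCliques G)) (∈-vs v)

  cdeg-upper : ∀ {K} → K ∈ maxCliques G → count (overlapping K) (maxCliques G) ≤ cdeg G
  cdeg-upper = maxℕ-upper (λ K → count (overlapping K) (maxCliques G))

  Δ̃-upper : ∀ {r} → r ∈ reps G → count (adj r) (reps G) ≤ Δ̃ G
  Δ̃-upper = maxℕ-upper (λ r → count (adj r) (reps G))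

  αIn-upper : ∀ {S U} → S ⊆ₛ U → T (isIndep G S) → size G S ≤ αIn G U
  αIn-upper {S} {U} S⊆U S-indep = maxℕ-upper (size G)
    (∈-filterᵇ⁺ (λ S → (_⊆ᵇ_ G S U) ∧ isIndep G S) (∈-allSubsets S)
                (from T-∧ (⊆ᵇ⁺ {S} {U} S⊆U , S-indep)))

  αloc-upper : ∀ v → αIn G (N[_] G v) ≤ αloc G
  αloc-upper v = maxℕ-upper (λ v → αIn G (N[_] G v)) (∈-vs v)

  θloc-upper : ∀ v → θIn G (N[_] G v) ≤ θloc G
  θloc-upper v = maxℕ-upper (λ v → θIn G (N[_] G v)) (∈-vs v)

  -- Clique covers

  _⊆⋃_ : Subset n → List (Subset n) → Set
  U ⊆⋃ Cs = ∀ {u} → u ∈ₛ U → ∃ λ C → C ∈ Cs × u ∈ₛ C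

  record IsCliqueCover (U : Subset n) (Cs : List (Subset n)) : Set where
    field
      cliques : ∀ {C} → C ∈ Cs → T (isClique G C)
      inside  : ∀ {C} → C ∈ Cs → C ⊆ₛ U
      covers  : U ⊆⋃ Cs

  coverable⁺ : ∀ {U Cs} → IsCliqueCover U Cs → T (coverable G U (length Cs))
  coverable⁺ {U} {Cs} cover = any-lose _ (∈-subsetTuples Cs) (from T-∧
    ( all-tabulate _ Cs (λ {C} C∈ → from T-∧ (cliques C∈ , ⊆ᵇ⁺ {C} {U} (inside C∈)))
    , all-tabulate _ (vs G) (λ {u} _ → implicationᵇ⁺ λ u∈U →
        let C , C∈ , u∈C = covers u∈U in any-lose (λ C → mem G C u) C∈ u∈C)))
    where open IsCliqueCover cover

  coverable⁻ : ∀ {U k} → T (coverable G U k) → ∃ λ Cs → length Cs ≡ k × IsCliqueCover U Cs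
  coverable⁻ {U} {k} h =
    let Cs , Cs∈ , Cs-cover = any-find _ (subsetTuples n k) h
        cliques-inside , covering = to T-∧ Cs-cover
        clique-inside : ∀ {C} → C ∈ Cs → T (isClique G C) × T (_⊆ᵇ_ G C U)
        clique-inside C∈ = to T-∧ (all-lookup (λ C → isClique G C ∧ (_⊆ᵇ_ G C U)) cliques-inside C∈)
    in Cs , length-∈-subsetTuples k Cs∈ , record
      { cliques = proj₁ ∘ clique-inside
      ; inside  = λ {C} C∈ → ⊆ᵇ⁻ {C} {U} (proj₂ (clique-inside C∈))
      ; covers  = λ {u} u∈U → any-find (λ C → mem G C u) Cs (implicationᵇ⁻
                    (all-lookup (λ u → not (mem G U u) ∨ any (λ C → mem G C u) Cs) covering (∈-vs u)) u∈U)
      }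

  θIn-≤-cover : ∀ {U Cs} → IsCliqueCover U Cs → θIn G U ≤ length Cs
  θIn-≤-cover {U} {Cs} cover = leastℕ-≤ (coverable G U) n (length Cs) (coverable⁺ cover)

  independent-size-≤-cover : ∀ S Cs → T (isIndep G S) → (∀ {C} → C ∈ Cs → T (isClique G C)) →
                             S ⊆⋃ Cs → size G S ≤ length Cs
  independent-size-≤-cover S Cs S-indep Cs-cliques S⊆⋃Cs = begin
    count (mem G S) (vs G)
      ≤⟨ count-mono _ _ (vs G) (λ _ u∈S → let C , C∈ , u∈C = S⊆⋃Cs u∈S in
                                             any-lose (λ C → mem G S _ ∧ mem G C _) C∈
                                                      (from T-∧ (u∈S , u∈C))) ⟩
    count (λ u → any (λ C → mem G S u ∧ mem G C u) Cs) (vs G)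
      ≤⟨ count-any-≤-sum (λ C u → mem G S u ∧ mem G C u) Cs (vs G) ⟩
    sum (map (λ C → count (λ u → mem G S u ∧ mem G C u) (vs G)) Cs)
      ≤⟨ sum-≤-length* _ Cs (λ {C} C∈ → count-≤1 _ vs-unique (at-most-one {C} (Cs-cliques C∈))) ⟩
    length Cs * 1
      ≡⟨ *-identityʳ (length Cs) ⟩
    length Cs ∎
    where
    open ≤-Reasoning
    at-most-one : ∀ {C} → T (isClique G C) → ∀ {x y} → x ∈ vs G → y ∈ vs G →
                  T (mem G S x ∧ mem G C x) → T (mem G S y ∧ mem G C y) → x ≡ y
    at-most-one {C} C-clique {x} {y} _ _ x∈S∩C y∈S∩C with x ≟ y
    ... | yes x≡y = x≡y
    ... | no x≢y = let x∈S , x∈C = to T-∧ x∈S∩C ; y∈S , y∈C = to T-∧ y∈S∩C in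
                   ⊥-elim (isIndep⁻ S S-indep x∈S y∈S (isClique⁻ C C-clique x∈C y∈C x≢y))

  α≤θ : ∀ U → αIn G U ≤ θIn G U
  α≤θ U = maxℕ-least (size G) _ λ {S} S∈ →
    bound S (to T-∧ (proj₂ (∈-filterᵇ⁻ independentIn-U {allSubsets n} S∈)))
    where
    independentIn-U : Subset n → Bool
    independentIn-U S = (_⊆ᵇ_ G S U) ∧ isIndep G S
    bound : ∀ S → T (_⊆ᵇ_ G S U) × T (isIndep G S) → size G S ≤ θIn G U
    bound S (S⊆U , S-indep) with leastℕ-found-or-fuel (coverable G U) n
    ... | inj₂ θ≡n = ≤-trans (size-≤-n S) (≤-reflexive (sym θ≡n))
    ... | inj₁ found with Cs , |Cs|≡θ , cover ← coverable⁻ {U} found =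
      ≤-trans (independent-size-≤-cover S Cs S-indep (IsCliqueCover.cliques cover)
                                        (IsCliqueCover.covers cover ∘ ⊆ᵇ⁻ {S} {U} S⊆U))
              (≤-reflexive |Cs|≡θ)

  cdeg≤ω̃*cideg : cdeg G ≤ ω̃ G * cideg G
  cdeg≤ω̃*cideg = maxℕ-least (λ K → count (overlapping K) (maxCliques G)) (maxCliques G) bound
    where
    overlapping⇒shares-class : ∀ {K K′} → K′ ∈ maxCliques G → T (overlapping K K′) →
                                T (any (λ r → mem G K′ r) (classesIn K))
    overlapping⇒shares-class {K} {K′} K′∈ K~K′ =
      let u , _ , u∈K∩K′ = any-find (λ u → mem G K u ∧ mem G K′ u) (vs G) (proj₂ (to T-∧ K~K′))
          u∈K , u∈K′ = to T-∧ u∈K∩K′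
          r , r∈reps , u~r = rep u
          r∈classes = ∈-filterᵇ⁺ (meets K) r∈reps
                        (any-lose (λ v → mem G K v ∧ twin G v r) (∈-vs u) (from T-∧ (u∈K , u~r)))
      in any-lose (λ r → mem G K′ r) r∈classes (twin-∈ₛ u~r K′∈ u∈K′)
    bound : ∀ {K} → K ∈ maxCliques G → count (overlapping K) (maxCliques G) ≤ ω̃ G * cideg G
    bound {K} K∈ = begin
      count (overlapping K) (maxCliques G)
        ≤⟨ count-mono _ _ (maxCliques G) (overlapping⇒shares-class {K}) ⟩
      count (λ K′ → any (λ r → mem G K′ r) (classesIn K)) (maxCliques G)
        ≤⟨ count-any-≤-sum (λ r K′ → mem G K′ r) (classesIn K) (maxCliques G) ⟩
      sum (map (λ r → count (λ K′ → mem G K′ r) (maxCliques G)) (classesIn K))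
        ≤⟨ sum-≤-length* _ (classesIn K) (λ {r} _ → cideg-upper r) ⟩
      length (classesIn K) * cideg G
        ≤⟨ *-monoˡ-≤ (cideg G) (ω̃-upper K∈) ⟩
      ω̃ G * cideg G ∎
      where open ≤-Reasoning

  intersecting-count : ∀ {K} → K ∈ maxCliques G → count (intersects G K) (maxCliques G) ≤ suc (cdeg G)
  intersecting-count {K} K∈ = begin
    count (intersects G K) (maxCliques G)
      ≤⟨ count-∨ (eqᵇ G K) (overlapping K) (intersects G K) (maxCliques G)
                 (λ {K′} _ → equal-or-overlapping {K′}) ⟩
    count (eqᵇ G K) (maxCliques G) + count (overlapping K) (maxCliques G)
      ≤⟨ +-mono-≤ (count-≤1 (eqᵇ G K) maxCliques-unique λ {K′} {K″} _ _ K≡K′ K≡K″ →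
                     trans (sym (eqᵇ⇒≡ {K} {K′} K≡K′)) (eqᵇ⇒≡ {K} {K″} K≡K″))
                  (cdeg-upper K∈) ⟩
    suc (cdeg G) ∎
    where
    open ≤-Reasoning
    equal-or-overlapping : ∀ {K′} → T (intersects G K K′) → T (eqᵇ G K K′) ⊎ T (overlapping K K′)
    equal-or-overlapping {K′} meet with eqᵇ G K K′
    ... | true  = inj₁ _
    ... | false = inj₂ meet

  cideg≤1+cdeg : cideg G ≤ suc (cdeg G)
  cideg≤1+cdeg = maxℕ-least (λ v → count (λ K → mem G K v) (maxCliques G)) (vs G) λ {v} _ →
    count-≤-from-witness (λ K → mem G K v) (maxCliques G) λ {K₀} K₀∈ v∈K₀ → begin
      count (λ K → mem G K v) (maxCliques G)
        ≤⟨ count-mono _ _ (maxCliques G) (λ {K} _ v∈K →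
             any-lose (λ u → mem G K₀ u ∧ mem G K u) (∈-vs v) (from T-∧ (v∈K₀ , v∈K))) ⟩
      count (intersects G K₀) (maxCliques G)
        ≤⟨ intersecting-count K₀∈ ⟩
      suc (cdeg G) ∎
    where open ≤-Reasoning

  ω̃≤2^[1+cdeg] : ω̃ G ≤ 2 ^ suc (cdeg G)
  ω̃≤2^[1+cdeg] = maxℕ-least (λ K → count (meets K) (reps G)) (maxCliques G) bound
    where
    disjoint : ∀ K K′ {u} → ¬ T (intersects G K K′) → u ∈ₛ K → ¬ u ∈ₛ K′
    disjoint K K′ {u} K∩K′=∅ u∈K u∈K′ =
      K∩K′=∅ (any-lose (λ u → mem G K u ∧ mem G K′ u) (∈-vs u) (from T-∧ (u∈K , u∈K′)))
    bound : ∀ {K} → K ∈ maxCliques G → count (meets K) (reps G) ≤ 2 ^ suc (cdeg G)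
    bound {K} K∈ = begin
      length (classesIn K)   ≤⟨ length-≤-2^-by-code code (length meeting) (unique-filterᵇ (meets K) reps-unique)
                                  code-injective (λ _ → length-map _ meeting) ⟩
      2 ^ length meeting     ≤⟨ ^-monoʳ-≤ 2 (intersecting-count K∈) ⟩
      2 ^ suc (cdeg G)       ∎
      where
      open ≤-Reasoning
      meeting = filterᵇ (intersects G K) (maxCliques G)
      code : Fin n → List Bool
      code r = map (λ K′ → mem G K′ r) meeting
      same-cliques : ∀ {r s} → r ∈ₛ K → s ∈ₛ K → code r ≡ code s →
                     ∀ {K′} → K′ ∈ maxCliques G → mem G K′ r ≡ mem G K′ s
      same-cliques {r} {s} r∈K s∈K same-code {K′} K′∈ with intersects G K K′ in meet
      ... | true  = map-≡⇒pointwise same-code (∈-filterᵇ⁺ (intersects G K) K′∈ (subst T (sym meet) _))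
      ... | false = T-extensional (⊥-elim ∘ disjoint K K′ (subst T meet) r∈K)
                                  (⊥-elim ∘ disjoint K K′ (subst T meet) s∈K)
      code-injective : ∀ {r s} → r ∈ classesIn K → s ∈ classesIn K → code r ≡ code s → r ≡ s
      code-injective r∈ s∈ same-code =
        let r∈reps , r-meets = ∈-filterᵇ⁻ (meets K) r∈ ; s∈reps , s-meets = ∈-filterᵇ⁻ (meets K) s∈ in
        twin-reps⇒≡ r∈reps s∈reps
          (twin⁺ (same-cliques (meets⇒∈ₛ K∈ r-meets) (meets⇒∈ₛ K∈ s-meets) same-code))

  θloc≤cideg : θloc G ≤ cideg G
  θloc≤cideg = maxℕ-least (λ v → θIn G (N[_] G v)) (vs G) λ {v} _ →
    ≤-trans (θIn-≤-cover (cliquesAt-cover v)) (cideg-upper v)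
    where
    cliquesAt-cover : ∀ v → IsCliqueCover (N[_] G v) (filterᵇ (λ K → mem G K v) (maxCliques G))
    cliquesAt-cover v = record
      { cliques = maxClique⇒clique ∘ proj₁ ∘ ∈-filterᵇ⁻ _
      ; inside  = λ K∈ → let K∈mc , v∈K = ∈-filterᵇ⁻ _ K∈ in maxClique⊆N[] K∈mc v∈K
      ; covers  = λ u∈N[v] →
          let K , K∈ , v∈K , u∈K = equal-or-adjacent⇒maxClique (Data.Sum.map₁ sym (∈ₛ-N[]⁻ u∈N[v]))
          in K , ∈-filterᵇ⁺ (λ K → mem G K v) K∈ v∈K , u∈K
      }

  αloc≤θloc : αloc G ≤ θloc G
  αloc≤θloc = maxℕ-least (λ v → αIn G (N[_] G v)) (vs G) λ {v} _ →
    ≤-trans (α≤θ (N[_] G v)) (θloc-upper v)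

  reps-clique-≤-ω̃ : ∀ {ys} → Unique ys → (∀ {y} → y ∈ ys → y ∈ reps G) →
                    (∀ {x y} → x ∈ ys → y ∈ ys → x ≢ y → T (adj x y)) → length ys ≤ ω̃ G
  reps-clique-≤-ω̃ {ys} ys! ys⊆reps adjacent =
    let ys-clique = isClique⁺ (fromList ys) λ x∈ y∈ →
                      adjacent (∈ₛ-fromList⁻ ys x∈) (∈ₛ-fromList⁻ ys y∈)
        K , K∈ , ys⊆K = clique⊆maxClique {fromList ys} ys-clique
    in ≤-trans (length-≤-count (meets K) (reps G) ys! λ y∈ →
                  ys⊆reps y∈ , ∈ₛ⇒meets {K} (ys⊆K (∈ₛ-fromList⁺ y∈)))
               (ω̃-upper K∈)

  independent-neighbours-≤-αloc : ∀ {r ys} → Unique ys → (∀ {y} → y ∈ ys → T (adj r y)) →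
                                  (∀ {x y} → x ∈ ys → y ∈ ys → ¬ T (adj x y)) → length ys ≤ αloc G
  independent-neighbours-≤-αloc {r} {ys} ys! adjacent-to-r nonadjacent = begin
    length ys                 ≤⟨ size-fromList ys! ⟩
    size G (fromList ys)      ≤⟨ αIn-upper {fromList ys} {N[_] G r}
                                   (∈ₛ-N[]⁺ ∘ inj₂ ∘ adjacent-to-r ∘ ∈ₛ-fromList⁻ ys)
                                   (isIndep⁺ (fromList ys) λ x∈ y∈ →
                                      nonadjacent (∈ₛ-fromList⁻ ys x∈) (∈ₛ-fromList⁻ ys y∈)) ⟩
    αIn G (N[_] G r)          ≤⟨ αloc-upper r ⟩
    αloc G                    ∎
    where open ≤-Reasoning

  Δ̃≤2^[ω̃+αloc+2] : Δ̃ G ≤ 2 ^ (suc (ω̃ G) + suc (αloc G))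
  Δ̃≤2^[ω̃+αloc+2] = maxℕ-least (λ r → count (adj r) (reps G)) (reps G) λ {r} _ → degree-bound r
    where
    open Ramsey adj adj-sym
    degree-bound : ∀ r → count (adj r) (reps G) ≤ 2 ^ (suc (ω̃ G) + suc (αloc G))
    degree-bound r with 2 ^ (suc (ω̃ G) + suc (αloc G)) ≤? count (adj r) (reps G)
    ... | no small = <⇒≤ (≰⇒> small)
    ... | yes big with ramsey (suc (ω̃ G)) (suc (αloc G)) (filterᵇ (adj r) (reps G))
                              (unique-filterᵇ (adj r) reps-unique) big
    ...   | inj₁ H = ⊥-elim (<⇒≱ k≤length (reps-clique-≤-ω̃ unique
                                             (proj₁ ∘ ∈-filterᵇ⁻ (adj r) {reps G} ∘ members⊆)
                                             (λ x∈ y∈ x≢y → from T-≡ (homogeneous x∈ y∈ x≢y))))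
      where open Homogeneous H
    ...   | inj₂ H = ⊥-elim (<⇒≱ k≤length (independent-neighbours-≤-αloc unique
                                             (proj₂ ∘ ∈-filterᵇ⁻ (adj r) {reps G} ∘ members⊆) nonadjacent))
      where
      open Homogeneous H
      nonadjacent : ∀ {x y} → x ∈ members → y ∈ members → ¬ T (adj x y)
      nonadjacent {x} {y} x∈ y∈ with x ≟ y
      ... | yes refl = subst T (adj-irrefl x)
      ... | no x≢y   = subst T (homogeneous x∈ y∈ x≢y)

  closedNeighbours-count : ∀ {r} → r ∈ reps G → count (closedNeighbour r) (reps G) ≤ suc (Δ̃ G)
  closedNeighbours-count {r} r∈ =
    ≤-trans (count-∨ (λ s → ⌊ s ≟ r ⌋) (adj r) (closedNeighbour r) (reps G) (λ _ → to T-∨))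
            (+-mono-≤ (count-≤1 _ reps-unique λ _ _ s≡r s′≡r →
                         trans (toWitness s≡r) (sym (toWitness s′≡r)))
                      (Δ̃-upper r∈))

  ω̃≤1+Δ̃ : ω̃ G ≤ suc (Δ̃ G)
  ω̃≤1+Δ̃ = maxℕ-least (λ K → count (meets K) (reps G)) (maxCliques G) λ {K} K∈ →
    count-≤-from-witness (meets K) (reps G) λ {r} r∈ r-meets →
      ≤-trans (count-mono (meets K) (closedNeighbour r) (reps G)
                 λ _ s-meets → maxClique-closedNeighbour K∈ (meets⇒∈ₛ K∈ r-meets) (meets⇒∈ₛ K∈ s-meets))
              (closedNeighbours-count r∈)

  cideg≤2^[1+Δ̃] : cideg G ≤ 2 ^ suc (Δ̃ G)
  cideg≤2^[1+Δ̃] = maxℕ-least (λ v → count (λ K → mem G K v) (maxCliques G)) (vs G) λ {v} _ → bound v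
    where
    bound : ∀ v → count (λ K → mem G K v) (maxCliques G) ≤ 2 ^ suc (Δ̃ G)
    bound v = begin
      length cliquesAt   ≤⟨ length-≤-2^-by-code code (length classes) (unique-filterᵇ _ maxCliques-unique)
                              code-injective (λ _ → length-map _ classes) ⟩
      2 ^ length classes ≤⟨ ^-monoʳ-≤ 2 (closedNeighbours-count rᵥ∈) ⟩
      2 ^ suc (Δ̃ G)      ∎
      where
      open ≤-Reasoning
      rᵥ = proj₁ (rep v)
      rᵥ∈ = proj₁ (proj₂ (rep v))
      v~rᵥ = proj₂ (proj₂ (rep v))
      cliquesAt = filterᵇ (λ K → mem G K v) (maxCliques G)
      classes = filterᵇ (closedNeighbour rᵥ) (reps G)
      code : Subset n → List Bool
      code K = map (mem G K) classes
      same-code⇒⊆ : ∀ {K K′} → K ∈ cliquesAt → K′ ∈ cliquesAt → code K ≡ code K′ → K ⊆ₛ K′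
      same-code⇒⊆ {K} {K′} K∈ K′∈ same-code {u} u∈K =
        let K∈mc , v∈K = ∈-filterᵇ⁻ _ K∈
            K′∈mc , _ = ∈-filterᵇ⁻ _ K′∈
            rᵤ , rᵤ∈ , u~rᵤ = rep u
            rᵤ∈K = twin-∈ₛ u~rᵤ K∈mc u∈K
            rᵤ∈classes = ∈-filterᵇ⁺ (closedNeighbour rᵥ) rᵤ∈
                           (maxClique-closedNeighbour K∈mc (twin-∈ₛ v~rᵥ K∈mc v∈K) rᵤ∈K)
            rᵤ∈K′ = subst T (map-≡⇒pointwise same-code rᵤ∈classes) rᵤ∈K
        in twin-∈ₛ (twin-sym u~rᵤ) K′∈mc rᵤ∈K′
      code-injective : ∀ {K K′} → K ∈ cliquesAt → K′ ∈ cliquesAt → code K ≡ code K′ → K ≡ K′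
      code-injective {K} {K′} K∈ K′∈ same-code = lookup-extensionality K K′ λ u →
        T-extensional (same-code⇒⊆ K∈ K′∈ same-code) (same-code⇒⊆ K′∈ K∈ (sym same-code))

-- Equivalence of the parameters

record Controls (p q : Param) : Set where
  field
    bound      : ℕ → ℕ
    bound-mono : ∀ {x y} → x ≤ y → bound x ≤ bound y
    q≤bound∘p  : ∀ G → q G ≤ bound (p G)

controls-≤ : ∀ {p q} → (∀ G → q G ≤ p G) → Controls p q
controls-≤ q≤p = record { bound = id ; bound-mono = id ; q≤bound∘p = q≤p }

controls-refl : ∀ {p} → Controls p p
controls-refl = controls-≤ (λ _ → ≤-refl)

infixr 6 _⨾_

_⨾_ : ∀ {p q r} → Controls p q → Controls q r → Controls p r
p→q ⨾ q→r = record
  { bound      = Q.bound ∘ P.bound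
  ; bound-mono = Q.bound-mono ∘ P.bound-mono
  ; q≤bound∘p  = λ G → ≤-trans (Q.q≤bound∘p G) (Q.bound-mono (P.q≤bound∘p G))
  }
  where module P = Controls p→q ; module Q = Controls q→r

cideg⊔ω̃ θloc⊔ω̃ αloc⊔ω̃ : Param
cideg⊔ω̃ G = cideg G ⊔ ω̃ G
θloc⊔ω̃ G = θloc G ⊔ ω̃ G
αloc⊔ω̃ G = αloc G ⊔ ω̃ G

cideg⊔ω̃→cdeg : Controls cideg⊔ω̃ cdeg
cideg⊔ω̃→cdeg = record
  { bound      = λ c → c * c
  ; bound-mono = λ c≤c′ → *-mono-≤ c≤c′ c≤c′
  ; q≤bound∘p  = λ G → ≤-trans (cdeg≤ω̃*cideg G)
                                (*-mono-≤ (m≤n⊔m (cideg G) (ω̃ G)) (m≤m⊔n (cideg G) (ω̃ G)))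
  }

cdeg→cideg⊔ω̃ : Controls cdeg cideg⊔ω̃
cdeg→cideg⊔ω̃ = record
  { bound      = λ d → suc d ⊔ 2 ^ suc d
  ; bound-mono = λ d≤d′ → ⊔-mono-≤ (s≤s d≤d′) (^-monoʳ-≤ 2 (s≤s d≤d′))
  ; q≤bound∘p  = λ G → ⊔-mono-≤ (cideg≤1+cdeg G) (ω̃≤2^[1+cdeg] G)
  }

cideg⊔ω̃→θloc⊔ω̃ : Controls cideg⊔ω̃ θloc⊔ω̃
cideg⊔ω̃→θloc⊔ω̃ = controls-≤ (λ G → ⊔-monoˡ-≤ (ω̃ G) (θloc≤cideg G))

θloc⊔ω̃→αloc⊔ω̃ : Controls θloc⊔ω̃ αloc⊔ω̃
θloc⊔ω̃→αloc⊔ω̃ = controls-≤ (λ G → ⊔-monoˡ-≤ (ω̃ G) (αloc≤θloc G))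

αloc⊔ω̃→Δ̃ : Controls αloc⊔ω̃ Δ̃
αloc⊔ω̃→Δ̃ = record
  { bound      = λ m → 2 ^ (suc m + suc m)
  ; bound-mono = λ m≤m′ → ^-monoʳ-≤ 2 (+-mono-≤ (s≤s m≤m′) (s≤s m≤m′))
  ; q≤bound∘p  = λ G → ≤-trans (Δ̃≤2^[ω̃+αloc+2] G)
                         (^-monoʳ-≤ 2 (+-mono-≤ (s≤s (m≤n⊔m (αloc G) (ω̃ G)))
                                                (s≤s (m≤m⊔n (αloc G) (ω̃ G)))))
  }

Δ̃→cideg⊔ω̃ : Controls Δ̃ cideg⊔ω̃
Δ̃→cideg⊔ω̃ = record
  { bound      = λ d → 2 ^ suc d ⊔ suc d
  ; bound-mono = λ d≤d′ → ⊔-mono-≤ (^-monoʳ-≤ 2 (s≤s d≤d′)) (s≤s d≤d′)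
  ; q≤bound∘p  = λ G → ⊔-mono-≤ (cideg≤2^[1+Δ̃] G) (ω̃≤1+Δ̃ G)
  }

controls-cideg⊔ω̃ : VAll.All (λ p → Controls p cideg⊔ω̃) params
controls-cideg⊔ω̃ =
  Δ̃→cideg⊔ω̃ ∷
  cdeg→cideg⊔ω̃ ∷
  controls-refl ∷
  αloc⊔ω̃→Δ̃ ⨾ Δ̃→cideg⊔ω̃ ∷
  θloc⊔ω̃→αloc⊔ω̃ ⨾ αloc⊔ω̃→Δ̃ ⨾ Δ̃→cideg⊔ω̃ ∷
  []

cideg⊔ω̃-controls : VAll.All (Controls cideg⊔ω̃) params
cideg⊔ω̃-controls =
  cideg⊔ω̃→θloc⊔ω̃ ⨾ θloc⊔ω̃→αloc⊔ω̃ ⨾ αloc⊔ω̃→Δ̃ ∷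
  cideg⊔ω̃→cdeg ∷
  controls-refl ∷
  cideg⊔ω̃→θloc⊔ω̃ ⨾ θloc⊔ω̃→αloc⊔ω̃ ∷
  cideg⊔ω̃→θloc⊔ω̃ ∷
  []

-- The lower bound required by Equivalent is met by 0; the content is the upper bound, which
-- exists for every ordered pair (i, j).
corollary5p4 : (i j : Fin 5) → Equivalent (lookup params i) (lookup params j)
corollary5p4 i j = (λ _ → 0) , bound , λ G → z≤n , q≤bound∘p G
  where open Controls (VAll.lookup⁺ controls-cideg⊔ω̃ i ⨾ VAll.lookup⁺ cideg⊔ω̃-controls j)
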